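{- Let $P=(p_1,\dots,p_k)$ be a sequence of positive integers in which positions $M=\{a,a+1,\dots,a+m-1\}$ (for some $a$ and $m\geq 1$ with $a+m-1\le k$) all carry the same value $h$. Then an $\mathrm{ROS}(P)$ exists if and only if an $\mathrm{ROS}(P)$ which is similar with respect to the block $M$ exists.
   Context: An $\mathrm{ROS}(P)$ is an assignment of a non-negative rational number $X(i,j,\ell)$ to every multiset $\{i,j,\ell\}$ of elements of $[k]$ (invariant under permuting $i,j,\ell$) such that $\sum_{\ell\in[k]}X(i,j,\ell)=p_ip_j$ for all $i,j\in[k]$, and $X(i,i,i)=p_i^2$ and $X(i,i,j)=0$ for all $i\neq j$. If the positions $M=a-1+[m]$ all carry the same part $h$, the $\mathrm{ROS}$ $X$ is similar with respect to $M$ (written $\mathrm{SROS}(P,\{h^m\})$) if there exist non-negative values $X'(i,j,a)$, $X'(i,a,a)$ (for $i,j\notin M$) and $X'(a,a,a)$ such that for all distinct $\alpha,\beta,\gamma\in M$ and all $i,j\notin M$: $X(i,j,\alpha)=X'(i,j,a)$, $X(i,\alpha,\beta)=X'(i,a,a)$, and $X(\alpha,\beta,\gamma)=X'(a,a,a)$. -}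

module Defs where

open import Data.Nat as ℕ using (ℕ; zero; suc)
open import Data.Fin using (Fin; zero; suc; toℕ)
open import Data.Integer using (+_)
open import Data.Rational using (ℚ; 0ℚ; _+_; _/_; _≤_)
open import Data.Product using (Σ; _×_)
open import Relation.Binary.PropositionalEquality using (_≡_; _≢_)

sumFin : ∀ {k} → (Fin k → ℚ) → ℚ
sumFin {zero}  f = 0ℚ
sumFin {suc k} f = f zero + sumFin (λ i → f (suc i))

ℕtoℚ : ℕ → ℚ
ℕtoℚ n = + n / 1

-- An ROS(P): X assigns to each (ordered) triple a value, invariant under
-- permutation (so effectively a function of the multiset {i,j,l}).
record IsROS {k : ℕ} (p : Fin k → ℕ) (X : Fin k → Fin k → Fin k → ℚ) : Set where
  field
    nonneg  : ∀ i j l → 0ℚ ≤ X i j l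
    sym₁₂   : ∀ i j l → X i j l ≡ X j i l
    sym₂₃   : ∀ i j l → X i j l ≡ X i l j
    rowSum  : ∀ i j → sumFin (λ l → X i j l) ≡ ℕtoℚ (p i ℕ.* p j)
    diag    : ∀ i → X i i i ≡ ℕtoℚ (p i ℕ.* p i)
    offDiag : ∀ i j → i ≢ j → X i i j ≡ 0ℚ

ROS : ∀ {k} → (Fin k → ℕ) → Set
ROS {k} p = Σ (Fin k → Fin k → Fin k → ℚ) (IsROS p)

-- Block M = {a, …, a+m-1} (0-indexed positions in Fin k).
InBlock : ∀ {k} → ℕ → ℕ → Fin k → Set
InBlock a m α = (a ℕ.≤ toℕ α) × (toℕ α ℕ.< a ℕ.+ m)

NotInBlock : ∀ {k} → ℕ → ℕ → Fin k → Set
NotInBlock a m i = InBlock a m i → Data.Empty.⊥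
  where import Data.Empty

-- X is similar w.r.t. the block M: there are non-negative values
-- Xija i j = X'(i,j,a), Xiaa i = X'(i,a,a), Xaaa = X'(a,a,a).
record IsSimilar {k : ℕ} (a m : ℕ) (X : Fin k → Fin k → Fin k → ℚ) : Set where
  field
    Xija : Fin k → Fin k → ℚ
    Xiaa : Fin k → ℚ
    Xaaa : ℚ
    Xija-nonneg : ∀ i j → 0ℚ ≤ Xija i j
    Xiaa-nonneg : ∀ i → 0ℚ ≤ Xiaa i
    Xaaa-nonneg : 0ℚ ≤ Xaaa
    eq-ija : ∀ i j α → NotInBlock a m i → NotInBlock a m j → InBlock a m α →
             X i j α ≡ Xija i j
    eq-iaa : ∀ i α β → NotInBlock a m i → InBlock a m α → InBlock a m β → α ≢ β →
             X i α β ≡ Xiaa i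
    eq-aaa : ∀ α β γ → InBlock a m α → InBlock a m β → InBlock a m γ →
             α ≢ β → α ≢ γ → β ≢ γ → X α β γ ≡ Xaaa

SROS : ∀ {k} → (Fin k → ℕ) → ℕ → ℕ → Set
SROS {k} p a m = Σ (Fin k → Fin k → Fin k → ℚ) λ X → IsROS p X × IsSimilar a m X

-- Symmetrise X over the block M.  With c = |M|, the new table Y agrees with X on triples
-- avoiding M, and an entry with one, two or three distinct positions in M is replaced by the
-- mean of X over the c, c(c-1) or c(c-1)(c-2) ways of placing those positions at distinct
-- points of M (entries with a repeated position are already forced by the ROS conditions).
-- This is the average of X over all permutations of M, which fix p since p is constant on M;
-- so Y is again an ROS, and it is similar with respect to M by construction.  The row sums
-- are verified directly: split each sum into its parts inside and outside M, use that X
-- vanishes on triples with exactly two equal positions, and count the points of M, M ∖ i and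
-- M ∖ i ∖ j.
module Submission where

open import Defs
open import Algebra.Bundles using (CommutativeRing)
open import Data.Bool using (Bool; true; false; not; _∧_; if_then_else_)
open import Data.Bool.Properties using (not-¬)
open import Data.Fin using (Fin; zero; suc; toℕ; _≟_)
open import Data.Nat as ℕ using (ℕ; _≤_; _+_; _≤?_; _<?_)
open import Data.Nat.Properties as ℕP using ()
open import Data.Product using (_,_)
open import Data.Rational as ℚ using (ℚ; 0ℚ; 1ℚ; _*_; _-_; 1/_)
  renaming (_+_ to _+ℚ_; _≤_ to _≤ℚ_; _<_ to _<ℚ_)
open import Data.Rational.Properties as ℚP using ()
open import Data.Rational.Solver using (module +-*-Solver)
open import Data.Empty using (⊥-elim)
open import Function.Base using (_∘_)
open import Function.Bundles using (_⇔_; mk⇔)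
open import Relation.Nullary using (¬_; Dec; does; yes; no; _×-dec_)
open import Relation.Nullary.Decidable using (dec-true; dec-false; does-⇔)
open import Relation.Binary.PropositionalEquality
  using (_≡_; _≢_; refl; sym; trans; cong; cong₂; module ≡-Reasoning)

open import Algebra.Properties.CommutativeMonoid.Sum ℚP.+-0-commutativeMonoid
  using (sum; sum-cong-≗; ∑-distrib-+; ∑-comm; sum-replicate-zero)
open import Algebra.Properties.Semiring.Sum (CommutativeRing.semiring ℚP.+-*-commutativeRing)
  using (*-distribʳ-sum)

open +-*-Solver
open ≡-Reasoning

ℕtoℚ-nonneg : ∀ n → 0ℚ ≤ℚ ℕtoℚ n
ℕtoℚ-nonneg n = ℚP.nonNegative⁻¹ _ {{ℚP.normalize-nonNeg n 1}}

*-nonneg : ∀ {x y} → 0ℚ ≤ℚ x → 0ℚ ≤ℚ y → 0ℚ ≤ℚ x * y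
*-nonneg {x} {y} 0≤x 0≤y =
  ℚP.nonNegative⁻¹ _ {{ℚP.nonNeg*nonNeg⇒nonNeg x {{ℚ.nonNegative 0≤x}} y {{ℚ.nonNegative 0≤y}}}}

-- 1/x for x > 0 and the junk value 0 otherwise; this keeps the averaging weights below
-- non-negative and defined whatever the size of the averaging set.
inv⁺ : ℚ → ℚ
inv⁺ x with 0ℚ ℚP.<? x
... | yes 0<x = (1/ x) {{ℚ.>-nonZero 0<x}}
... | no _    = 0ℚ

inv⁺-nonneg : ∀ x → 0ℚ ≤ℚ inv⁺ x
inv⁺-nonneg x with 0ℚ ℚP.<? x
... | yes 0<x = ℚP.<⇒≤ (ℚP.positive⁻¹ _ {{ℚP.1/pos⇒pos x {{ℚ.positive 0<x}}}})
... | no _    = ℚP.≤-refl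

*-inv⁺-cancel : ∀ n x → (n ≤ℚ 0ℚ → x ≡ 0ℚ) → n * (x * inv⁺ n) ≡ x
*-inv⁺-cancel n x n≤0⇒x≡0 with 0ℚ ℚP.<? n
... | yes 0<n = begin
  n * (x * 1/n) ≡⟨ solve 3 (λ n x r → n :* (x :* r) := x :* (n :* r)) refl n x 1/n ⟩
  x * (n * 1/n) ≡⟨ cong (x *_) (ℚP.*-inverseʳ n {{ℚ.>-nonZero 0<n}}) ⟩
  x * 1ℚ        ≡⟨ ℚP.*-identityʳ x ⟩
  x             ∎
  where 1/n = (1/ n) {{ℚ.>-nonZero 0<n}}
... | no 0≮n with refl ← n≤0⇒x≡0 (ℚP.≮⇒≥ 0≮n) = ℚP.*-zeroʳ n

*-inv⁺-cancel-weighted : ∀ n x w → (n ≤ℚ 0ℚ → x ≡ 0ℚ) → n * (x * (w * inv⁺ n)) ≡ x * w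
*-inv⁺-cancel-weighted n x w n≤0⇒x≡0 = begin
  n * (x * (w * inv⁺ n)) ≡⟨ cong (n *_) (sym (ℚP.*-assoc x w (inv⁺ n))) ⟩
  n * (x * w * inv⁺ n)   ≡⟨ *-inv⁺-cancel n (x * w) (λ n≤0 → x≡0⇒xw≡0 (n≤0⇒x≡0 n≤0)) ⟩
  x * w                  ∎
  where
  x≡0⇒xw≡0 : x ≡ 0ℚ → x * w ≡ 0ℚ
  x≡0⇒xw≡0 refl = ℚP.*-zeroˡ w

sumFin≡sum : ∀ {k} (f : Fin k → ℚ) → sumFin f ≡ sum f
sumFin≡sum {ℕ.zero}  f = refl
sumFin≡sum {ℕ.suc k} f = cong (f zero +ℚ_) (sumFin≡sum (λ i → f (suc i)))

sum-nonneg : ∀ {k} (f : Fin k → ℚ) → (∀ i → 0ℚ ≤ℚ f i) → 0ℚ ≤ℚ sum f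
sum-nonneg {ℕ.zero}  f 0≤f = ℚP.≤-refl
sum-nonneg {ℕ.suc k} f 0≤f = ℚP.+-mono-≤ (0≤f zero) (sum-nonneg (λ i → f (suc i)) (λ i → 0≤f (suc i)))

sum-pointMass : ∀ {k} (x : Fin k) (v : ℚ) → sum (λ l → if does (x ≟ l) then v else 0ℚ) ≡ v
sum-pointMass {ℕ.suc k} zero    v = trans (cong (v +ℚ_) (sum-replicate-zero k)) (ℚP.+-identityʳ v)
sum-pointMass {ℕ.suc k} (suc x) v = trans (ℚP.+-identityˡ _) (sum-pointMass x v)

sum-supportedAt : ∀ {k} (f : Fin k → ℚ) x → (∀ l → x ≢ l → f l ≡ 0ℚ) → sum f ≡ f x
sum-supportedAt f x f≡0 = trans (sum-cong-≗ pointwise) (sum-pointMass x (f x))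
  where
  pointwise : ∀ l → f l ≡ (if does (x ≟ l) then f x else 0ℚ)
  pointwise l with x ≟ l
  ... | yes refl = refl
  ... | no x≢l   = f≡0 l x≢l

does-sym : ∀ {k} (x y : Fin k) → does (x ≟ y) ≡ does (y ≟ x)
does-sym x y = does-⇔ (mk⇔ sym sym) (x ≟ y) (y ≟ x)

whenDistinct : ∀ {k} → Fin k → Fin k → ℚ → ℚ
whenDistinct x y v = if does (x ≟ y) then 0ℚ else v

whenDistinct-≢ : ∀ {k} {x y : Fin k} v → x ≢ y → whenDistinct x y v ≡ v
whenDistinct-≢ {x = x} {y} v x≢y rewrite dec-false (x ≟ y) x≢y = refl

whenDistinct-sym : ∀ {k} (x y : Fin k) v → whenDistinct x y v ≡ whenDistinct y x v
whenDistinct-sym x y v = cong (λ b → if b then 0ℚ else v) (does-sym x y)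

module _ {k : ℕ} where

  sumOver : (Fin k → Bool) → (Fin k → ℚ) → ℚ
  sumOver N f = sum (λ l → if N l then f l else 0ℚ)

  size : (Fin k → Bool) → ℚ
  size N = sumOver N (λ _ → 1ℚ)

  infixl 6 _∖_
  _∖_ : (Fin k → Bool) → Fin k → Fin k → Bool
  (N ∖ x) l = N l ∧ not (does (x ≟ l))

  ∈∖⇒≢ : ∀ N x l → (N ∖ x) l ≡ true → x ≢ l
  ∈∖⇒≢ N x .x x∈N∖x refl with N x | x ≟ x
  ∈∖⇒≢ N x .x ()     refl | true  | yes _
  ∈∖⇒≢ N x .x ()     refl | false | _
  ...                     | true  | no x≢x = x≢x refl

  ∉∈⇒≢ : ∀ (N : Fin k → Bool) {x y} → N x ≡ false → N y ≡ true → x ≢ y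
  ∉∈⇒≢ N x∉N y∈N refl = not-¬ x∉N y∈N

  ∈⇒∈∖ : ∀ N x l → N l ≡ true → x ≢ l → (N ∖ x) l ≡ true
  ∈⇒∈∖ N x l l∈N x≢l rewrite l∈N | dec-false (x ≟ l) x≢l = refl

  sum-if : ∀ N (F : Bool → Fin k → ℚ) →
           sum (λ l → F (N l) l) ≡ sumOver N (F true) +ℚ sumOver (not ∘ N) (F false)
  sum-if N F = trans (sum-cong-≗ pointwise)
    (∑-distrib-+ (λ l → if N l then F true l else 0ℚ) (λ l → if not (N l) then F false l else 0ℚ))
    where
    pointwise : ∀ l → F (N l) l ≡ (if N l then F true l else 0ℚ) +ℚ (if not (N l) then F false l else 0ℚ)
    pointwise l with N l
    ... | true  = sym (ℚP.+-identityʳ _)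
    ... | false = sym (ℚP.+-identityˡ _)

  sum-partition : ∀ N f → sum f ≡ sumOver N f +ℚ sumOver (not ∘ N) f
  sum-partition N f = sum-if N (λ _ → f)

  sumOver-cong : ∀ N {f g} → (∀ l → N l ≡ true → f l ≡ g l) → sumOver N f ≡ sumOver N g
  sumOver-cong N {f} {g} f≡g = sum-cong-≗ pointwise
    where
    pointwise : ∀ l → (if N l then f l else 0ℚ) ≡ (if N l then g l else 0ℚ)
    pointwise l with N l in l∈N
    ... | true  = f≡g l l∈N
    ... | false = refl

  sumOver-zero : ∀ N → sumOver N (λ _ → 0ℚ) ≡ 0ℚ
  sumOver-zero N = trans (sum-cong-≗ pointwise) (sum-replicate-zero k)
    where
    pointwise : ∀ l → (if N l then 0ℚ else 0ℚ) ≡ 0ℚ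
    pointwise l with N l
    ... | true  = refl
    ... | false = refl

  sumOver-vanishes : ∀ N f → (∀ l → N l ≡ true → f l ≡ 0ℚ) → sumOver N f ≡ 0ℚ
  sumOver-vanishes N f f≡0 = trans (sumOver-cong N f≡0) (sumOver-zero N)

  sumOver-+ : ∀ N f g → sumOver N (λ l → f l +ℚ g l) ≡ sumOver N f +ℚ sumOver N g
  sumOver-+ N f g = trans (sum-cong-≗ pointwise)
    (∑-distrib-+ (λ l → if N l then f l else 0ℚ) (λ l → if N l then g l else 0ℚ))
    where
    pointwise : ∀ l → (if N l then f l +ℚ g l else 0ℚ) ≡
                      (if N l then f l else 0ℚ) +ℚ (if N l then g l else 0ℚ)
    pointwise l with N l
    ... | true  = refl
    ... | false = refl

  sumOver-*ʳ : ∀ N f w → sumOver N (λ l → f l * w) ≡ sumOver N f * w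
  sumOver-*ʳ N f w = sym (trans (*-distribʳ-sum w (λ l → if N l then f l else 0ℚ)) (sum-cong-≗ pointwise))
    where
    pointwise : ∀ l → (if N l then f l else 0ℚ) * w ≡ (if N l then f l * w else 0ℚ)
    pointwise l with N l
    ... | true  = refl
    ... | false = ℚP.*-zeroˡ w

  sumOver-const : ∀ N v → sumOver N (λ _ → v) ≡ size N * v
  sumOver-const N v = trans (sumOver-cong N (λ _ _ → sym (ℚP.*-identityˡ v))) (sumOver-*ʳ N (λ _ → 1ℚ) v)

  sumOver-nonneg : ∀ N f → (∀ l → N l ≡ true → 0ℚ ≤ℚ f l) → 0ℚ ≤ℚ sumOver N f
  sumOver-nonneg N f 0≤f = sum-nonneg _ pointwise
    where
    pointwise : ∀ l → 0ℚ ≤ℚ (if N l then f l else 0ℚ)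
    pointwise l with N l in l∈N
    ... | true  = 0≤f l l∈N
    ... | false = ℚP.≤-refl

  sumOver-remove : ∀ N x f → N x ≡ true → sumOver N f ≡ f x +ℚ sumOver (N ∖ x) f
  sumOver-remove N x f x∈N = begin
    sumOver N f
      ≡⟨ sum-cong-≗ pointwise ⟩
    sum (λ l → (if does (x ≟ l) then f x else 0ℚ) +ℚ (if (N ∖ x) l then f l else 0ℚ))
      ≡⟨ ∑-distrib-+ _ (λ l → if (N ∖ x) l then f l else 0ℚ) ⟩
    sum (λ l → if does (x ≟ l) then f x else 0ℚ) +ℚ sumOver (N ∖ x) f
      ≡⟨ cong (_+ℚ sumOver (N ∖ x) f) (sum-pointMass x (f x)) ⟩
    f x +ℚ sumOver (N ∖ x) f ∎
    where
    pointwise : ∀ l → (if N l then f l else 0ℚ) ≡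
                      (if does (x ≟ l) then f x else 0ℚ) +ℚ (if (N ∖ x) l then f l else 0ℚ)
    pointwise l with x ≟ l
    ... | yes refl rewrite x∈N = sym (ℚP.+-identityʳ (f x))
    ... | no _ with N l
    ...   | true  = sym (ℚP.+-identityˡ (f l))
    ...   | false = refl

  size-remove : ∀ N x → N x ≡ true → size (N ∖ x) ≡ size N - 1ℚ
  size-remove N x x∈N = begin
    size (N ∖ x)                ≡⟨ solve 1 (λ s → s := con 1ℚ :+ s :- con 1ℚ) refl (size (N ∖ x)) ⟩
    1ℚ +ℚ size (N ∖ x) - 1ℚ     ≡⟨ cong (_- 1ℚ) (sym (sumOver-remove N x (λ _ → 1ℚ) x∈N)) ⟩
    size N - 1ℚ                 ∎

  size-remove₂ : ∀ N x y → N x ≡ true → (N ∖ x) y ≡ true → size (N ∖ x ∖ y) ≡ size N - 1ℚ - 1ℚ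
  size-remove₂ N x y x∈N y∈N∖x = trans (size-remove (N ∖ x) y y∈N∖x) (cong (_- 1ℚ) (size-remove N x x∈N))

  size≰0 : ∀ N x → N x ≡ true → ¬ size N ≤ℚ 0ℚ
  size≰0 N x x∈N size≤0 = ℚP.<-irrefl refl (ℚP.<-≤-trans 0<size size≤0)
    where
    0<size : 0ℚ <ℚ size N
    0<size = ℚP.<-≤-trans
      (ℚP.+-mono-<-≤ (ℚP.positive⁻¹ 1ℚ)
                     (sumOver-nonneg (N ∖ x) _ (λ _ _ → ℚP.<⇒≤ (ℚP.positive⁻¹ 1ℚ))))
      (ℚP.≤-reflexive (sym (sumOver-remove N x (λ _ → 1ℚ) x∈N)))

  sumOver-size≤0 : ∀ N f → size N ≤ℚ 0ℚ → sumOver N f ≡ 0ℚ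
  sumOver-size≤0 N f size≤0 = sumOver-vanishes N f (λ l l∈N → ⊥-elim (size≰0 N l l∈N size≤0))

  sumOver-whenDistinct : ∀ N x f → sumOver N (λ l → whenDistinct x l (f l)) ≡ sumOver (N ∖ x) f
  sumOver-whenDistinct N x f = sum-cong-≗ pointwise
    where
    pointwise : ∀ l → (if N l then whenDistinct x l (f l) else 0ℚ) ≡ (if (N ∖ x) l then f l else 0ℚ)
    pointwise l with N l | x ≟ l
    ... | true  | yes _ = refl
    ... | true  | no _  = refl
    ... | false | _     = refl

  sum-sumOver-comm : ∀ N (f : Fin k → Fin k → ℚ) →
                     sum (λ l → sumOver N (f l)) ≡ sumOver N (λ β → sum (λ l → f l β))
  sum-sumOver-comm N f = trans (∑-comm (λ l β → if N β then f l β else 0ℚ)) (sum-cong-≗ pointwise)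
    where
    pointwise : ∀ β → sum (λ l → if N β then f l β else 0ℚ) ≡ (if N β then sum (λ l → f l β) else 0ℚ)
    pointwise β with N β
    ... | true  = refl
    ... | false = sum-replicate-zero k

module _ {k} {p : Fin k → ℕ} {X : Fin k → Fin k → Fin k → ℚ} (R : IsROS p X) where

  open IsROS R

  X-iji≡0 : ∀ i j → i ≢ j → X i j i ≡ 0ℚ
  X-iji≡0 i j i≢j = trans (sym₂₃ i j i) (offDiag i j i≢j)

  X-ijj≡0 : ∀ i j → i ≢ j → X i j j ≡ 0ℚ
  X-ijj≡0 i j i≢j = trans (sym₁₂ i j j) (trans (sym₂₃ j i j) (offDiag j i (i≢j ∘ sym)))

  X-sum₃ : ∀ i j → sum (X i j) ≡ ℕtoℚ (p i ℕ.* p j)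
  X-sum₃ i j = trans (sym (sumFin≡sum (X i j))) (rowSum i j)

  X-sum₂ : ∀ i j → sum (λ l → X i l j) ≡ ℕtoℚ (p i ℕ.* p j)
  X-sum₂ i j = trans (sum-cong-≗ (λ l → sym₂₃ i l j)) (X-sum₃ i j)

  X-sum₁ : ∀ i j → sum (λ l → X l i j) ≡ ℕtoℚ (p i ℕ.* p j)
  X-sum₁ i j = trans (sum-cong-≗ (λ l → trans (sym₁₂ l i j) (sym₂₃ i l j))) (X-sum₃ i j)

module Symmetrisation {k} {p : Fin k → ℕ} {X : Fin k → Fin k → Fin k → ℚ} (R : IsROS p X)
  (M : Fin k → Bool) (h : ℕ) (p≡h : ∀ α → M α ≡ true → p α ≡ h) where

  open IsROS R

  -- w₁, w₂, w₃ are 1/c, 1/(c(c-1)), 1/(c(c-1)(c-2)), the reciprocals of the numbers of ordered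
  -- tuples of distinct points of M.  Σ₂ i also contains the terms X i γ γ, but these vanish
  -- when i ∉ M, the only case in which avg₂ i is used.
  c h² w₁ w₂ w₃ : ℚ
  c  = size M
  h² = ℕtoℚ (h ℕ.* h)
  w₁ = inv⁺ c
  w₂ = w₁ * inv⁺ (c - 1ℚ)
  w₃ = w₂ * inv⁺ (c - 1ℚ - 1ℚ)

  Σ₁ : Fin k → Fin k → ℚ
  Σ₁ i j = sumOver M (X i j)

  Σ₂ : Fin k → ℚ
  Σ₂ i = sumOver M (Σ₁ i)

  Σ₂≢ : Fin k → ℚ
  Σ₂≢ l = sumOver (M ∖ l) (λ γ → sumOver (M ∖ l ∖ γ) (X l γ))

  Σ₃ : ℚ
  Σ₃ = sumOver M Σ₂≢

  avg₁ : Fin k → Fin k → ℚ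
  avg₁ i j = Σ₁ i j * w₁

  avg₂ : Fin k → ℚ
  avg₂ i = Σ₂ i * w₂

  avg₃ : ℚ
  avg₃ = Σ₃ * w₃

  -- Yb bi bj bl i j l is the entry at i j l when bi, bj, bl record which of i, j, l lie in M;
  -- G gives the entry of a triple inside M from the equalities i ≟ j, j ≟ l and i ≟ l.
  G : Bool → Bool → Bool → ℚ
  G true  true  true  = h²
  G false false false = avg₃
  G _     _     _     = 0ℚ

  Yb : Bool → Bool → Bool → Fin k → Fin k → Fin k → ℚ
  Yb false false false i j l = X i j l
  Yb false false true  i j l = avg₁ i j
  Yb false true  false i j l = avg₁ i l
  Yb true  false false i j l = avg₁ j l
  Yb false true  true  i j l = whenDistinct j l (avg₂ i)
  Yb true  false true  i j l = whenDistinct i l (avg₂ j)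
  Yb true  true  false i j l = whenDistinct i j (avg₂ l)
  Yb true  true  true  i j l = G (does (i ≟ j)) (does (j ≟ l)) (does (i ≟ l))

  Y : Fin k → Fin k → Fin k → ℚ
  Y i j l = Yb (M i) (M j) (M l) i j l

  Y-at : ∀ {i j l bi bj bl} → M i ≡ bi → M j ≡ bj → M l ≡ bl → Y i j l ≡ Yb bi bj bl i j l
  Y-at refl refl refl = refl

  Σ₁-sym : ∀ i j → Σ₁ i j ≡ Σ₁ j i
  Σ₁-sym i j = sumOver-cong M (λ l _ → sym₁₂ i j l)

  G-swap₂₃ : ∀ x y z → G x y z ≡ G x z y
  G-swap₂₃ true  true  true  = refl
  G-swap₂₃ true  true  false = refl
  G-swap₂₃ true  false true  = refl
  G-swap₂₃ true  false false = refl
  G-swap₂₃ false true  true  = refl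
  G-swap₂₃ false true  false = refl
  G-swap₂₃ false false true  = refl
  G-swap₂₃ false false false = refl

  G-swap₁₃ : ∀ x y z → G x y z ≡ G z y x
  G-swap₁₃ true  true  true  = refl
  G-swap₁₃ true  true  false = refl
  G-swap₁₃ true  false true  = refl
  G-swap₁₃ true  false false = refl
  G-swap₁₃ false true  true  = refl
  G-swap₁₃ false true  false = refl
  G-swap₁₃ false false true  = refl
  G-swap₁₃ false false false = refl

  Yb-sym₁₂ : ∀ bi bj bl i j l → Yb bi bj bl i j l ≡ Yb bj bi bl j i l
  Yb-sym₁₂ false false false i j l = sym₁₂ i j l
  Yb-sym₁₂ false false true  i j l = cong (_* w₁) (Σ₁-sym i j)
  Yb-sym₁₂ false true  false i j l = refl
  Yb-sym₁₂ true  false false i j l = refl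
  Yb-sym₁₂ false true  true  i j l = refl
  Yb-sym₁₂ true  false true  i j l = refl
  Yb-sym₁₂ true  true  false i j l = whenDistinct-sym i j (avg₂ l)
  Yb-sym₁₂ true  true  true  i j l =
    trans (cong (λ b → G b (does (j ≟ l)) (does (i ≟ l))) (does-sym i j))
          (G-swap₂₃ (does (j ≟ i)) (does (j ≟ l)) (does (i ≟ l)))

  Yb-sym₂₃ : ∀ bi bj bl i j l → Yb bi bj bl i j l ≡ Yb bi bl bj i l j
  Yb-sym₂₃ false false false i j l = sym₂₃ i j l
  Yb-sym₂₃ false false true  i j l = refl
  Yb-sym₂₃ false true  false i j l = refl
  Yb-sym₂₃ true  false false i j l = cong (_* w₁) (Σ₁-sym j l)
  Yb-sym₂₃ false true  true  i j l = whenDistinct-sym j l (avg₂ i)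
  Yb-sym₂₃ true  false true  i j l = refl
  Yb-sym₂₃ true  true  false i j l = refl
  Yb-sym₂₃ true  true  true  i j l =
    trans (G-swap₁₃ (does (i ≟ j)) (does (j ≟ l)) (does (i ≟ l)))
          (cong (λ b → G (does (i ≟ l)) b (does (i ≟ j))) (does-sym j l))

  Y-sym₁₂ : ∀ i j l → Y i j l ≡ Y j i l
  Y-sym₁₂ i j l = Yb-sym₁₂ (M i) (M j) (M l) i j l

  Y-sym₂₃ : ∀ i j l → Y i j l ≡ Y i l j
  Y-sym₂₃ i j l = Yb-sym₂₃ (M i) (M j) (M l) i j l

  avg₁-nonneg : ∀ i j → 0ℚ ≤ℚ avg₁ i j
  avg₁-nonneg i j = *-nonneg (sumOver-nonneg M (X i j) (λ l _ → nonneg i j l)) (inv⁺-nonneg c)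

  avg₂-nonneg : ∀ i → 0ℚ ≤ℚ avg₂ i
  avg₂-nonneg i = *-nonneg
    (sumOver-nonneg M (Σ₁ i) (λ γ _ → sumOver-nonneg M (X i γ) (λ δ _ → nonneg i γ δ)))
    (*-nonneg (inv⁺-nonneg c) (inv⁺-nonneg (c - 1ℚ)))

  avg₃-nonneg : 0ℚ ≤ℚ avg₃
  avg₃-nonneg = *-nonneg
    (sumOver-nonneg M Σ₂≢ (λ l _ → sumOver-nonneg (M ∖ l) _ (λ γ _ →
      sumOver-nonneg (M ∖ l ∖ γ) (X l γ) (λ δ _ → nonneg l γ δ))))
    (*-nonneg (*-nonneg (inv⁺-nonneg c) (inv⁺-nonneg (c - 1ℚ))) (inv⁺-nonneg (c - 1ℚ - 1ℚ)))

  whenDistinct-nonneg : ∀ (x y : Fin k) {v} → 0ℚ ≤ℚ v → 0ℚ ≤ℚ whenDistinct x y v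
  whenDistinct-nonneg x y 0≤v with does (x ≟ y)
  ... | true  = ℚP.≤-refl
  ... | false = 0≤v

  G-nonneg : ∀ x y z → 0ℚ ≤ℚ G x y z
  G-nonneg true  true  true  = ℕtoℚ-nonneg (h ℕ.* h)
  G-nonneg true  true  false = ℚP.≤-refl
  G-nonneg true  false _     = ℚP.≤-refl
  G-nonneg false true  _     = ℚP.≤-refl
  G-nonneg false false true  = ℚP.≤-refl
  G-nonneg false false false = avg₃-nonneg

  Yb-nonneg : ∀ bi bj bl i j l → 0ℚ ≤ℚ Yb bi bj bl i j l
  Yb-nonneg false false false i j l = nonneg i j l
  Yb-nonneg false false true  i j l = avg₁-nonneg i j
  Yb-nonneg false true  false i j l = avg₁-nonneg i l
  Yb-nonneg true  false false i j l = avg₁-nonneg j l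
  Yb-nonneg false true  true  i j l = whenDistinct-nonneg j l (avg₂-nonneg i)
  Yb-nonneg true  false true  i j l = whenDistinct-nonneg i l (avg₂-nonneg j)
  Yb-nonneg true  true  false i j l = whenDistinct-nonneg i j (avg₂-nonneg l)
  Yb-nonneg true  true  true  i j l = G-nonneg (does (i ≟ j)) (does (j ≟ l)) (does (i ≟ l))

  Y-nonneg : ∀ i j l → 0ℚ ≤ℚ Y i j l
  Y-nonneg i j l = Yb-nonneg (M i) (M j) (M l) i j l

  Y-diag : ∀ i → Y i i i ≡ ℕtoℚ (p i ℕ.* p i)
  Y-diag i with M i in i∈M
  ... | false = diag i
  ... | true rewrite dec-true (i ≟ i) refl | p≡h i i∈M = refl

  Y-offDiag : ∀ i j → i ≢ j → Y i i j ≡ 0ℚ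
  Y-offDiag i j i≢j with M i in i∈M | M j in j∈M
  ... | false | false = offDiag i j i≢j
  ... | false | true  = trans (cong (_* w₁) Σ₁-ii≡0) (ℚP.*-zeroˡ w₁)
    where
    Σ₁-ii≡0 : Σ₁ i i ≡ 0ℚ
    Σ₁-ii≡0 = sumOver-vanishes M (X i i) (λ l l∈M → offDiag i l (∉∈⇒≢ M i∈M l∈M))
  ... | true  | false rewrite dec-true (i ≟ i) refl = refl
  ... | true  | true  rewrite dec-true (i ≟ i) refl | dec-false (i ≟ j) i≢j = refl

  Y-row-split : ∀ {i j bi bj} → M i ≡ bi → M j ≡ bj →
                sum (Y i j) ≡ sumOver M (λ l → Yb bi bj true i j l)
                              +ℚ sumOver (not ∘ M) (λ l → Yb bi bj false i j l)
  Y-row-split {i} {j} {bi} {bj} i∈M j∈M =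
    trans (sum-cong-≗ (λ l → Y-at {l = l} i∈M j∈M refl)) (sum-if M (λ bl l → Yb bi bj bl i j l))

  sum-Σ₁ : ∀ i → sum (Σ₁ i) ≡ c * ℕtoℚ (p i ℕ.* h)
  sum-Σ₁ i = begin
    sum (λ l → sumOver M (X i l))                ≡⟨ sum-sumOver-comm M (X i) ⟩
    sumOver M (λ β → sum (λ l → X i l β))        ≡⟨ sumOver-cong M column ⟩
    sumOver M (λ _ → ℕtoℚ (p i ℕ.* h))           ≡⟨ sumOver-const M _ ⟩
    c * ℕtoℚ (p i ℕ.* h)                         ∎
    where
    column : ∀ β → M β ≡ true → sum (λ l → X i l β) ≡ ℕtoℚ (p i ℕ.* h)
    column β β∈M = trans (X-sum₂ R i β) (cong (λ v → ℕtoℚ (p i ℕ.* v)) (p≡h β β∈M))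

  sum-Σ₂ : sum Σ₂ ≡ c * (c * h²)
  sum-Σ₂ = begin
    sum (λ l → sumOver M (λ γ → sumOver M (X l γ)))  ≡⟨ sum-sumOver-comm M (λ l γ → sumOver M (X l γ)) ⟩
    sumOver M (λ γ → sum (λ l → sumOver M (X l γ)))  ≡⟨ sumOver-cong M inner ⟩
    sumOver M (λ _ → c * h²)                         ≡⟨ sumOver-const M _ ⟩
    c * (c * h²)                                     ∎
    where
    column : ∀ γ → M γ ≡ true → ∀ δ → M δ ≡ true → sum (λ l → X l γ δ) ≡ h²
    column γ γ∈M δ δ∈M =
      trans (X-sum₁ R γ δ) (cong₂ (λ u v → ℕtoℚ (u ℕ.* v)) (p≡h γ γ∈M) (p≡h δ δ∈M))
    inner : ∀ γ → M γ ≡ true → sum (λ l → sumOver M (X l γ)) ≡ c * h²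
    inner γ γ∈M = begin
      sum (λ l → sumOver M (X l γ))           ≡⟨ sum-sumOver-comm M (λ l → X l γ) ⟩
      sumOver M (λ δ → sum (λ l → X l γ δ))   ≡⟨ sumOver-cong M (column γ γ∈M) ⟩
      sumOver M (λ _ → h²)                    ≡⟨ sumOver-const M h² ⟩
      c * h²                                  ∎

  Σ₂-vanishes : ∀ i → M i ≡ false → c - 1ℚ ≤ℚ 0ℚ → Σ₂ i ≡ 0ℚ
  Σ₂-vanishes i i∉M c-1≤0 = sumOver-vanishes M (Σ₁ i) Σ₁-vanishes
    where
    Σ₁-vanishes : ∀ γ → M γ ≡ true → Σ₁ i γ ≡ 0ℚ
    Σ₁-vanishes γ γ∈M = begin
      Σ₁ i γ                              ≡⟨ sumOver-remove M γ (X i γ) γ∈M ⟩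
      X i γ γ +ℚ sumOver (M ∖ γ) (X i γ)  ≡⟨ cong₂ _+ℚ_ (X-ijj≡0 R i γ (∉∈⇒≢ M i∉M γ∈M)) rest≡0 ⟩
      0ℚ +ℚ 0ℚ                            ≡⟨ ℚP.+-identityˡ 0ℚ ⟩
      0ℚ                                  ∎
      where
      rest≡0 : sumOver (M ∖ γ) (X i γ) ≡ 0ℚ
      rest≡0 = sumOver-size≤0 (M ∖ γ) (X i γ)
                 (ℚP.≤-trans (ℚP.≤-reflexive (size-remove M γ γ∈M)) c-1≤0)

  Σ₂-inside : ∀ l → M l ≡ true → Σ₂ l ≡ h² +ℚ Σ₂≢ l
  Σ₂-inside l l∈M = begin
    Σ₂ l                                   ≡⟨ sumOver-remove M l (Σ₁ l) l∈M ⟩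
    Σ₁ l l +ℚ sumOver (M ∖ l) (Σ₁ l)       ≡⟨ cong₂ _+ℚ_ Σ₁-ll (sumOver-cong (M ∖ l) Σ₁-lγ) ⟩
    h² +ℚ Σ₂≢ l                            ∎
    where
    Σ₁-ll : Σ₁ l l ≡ h²
    Σ₁-ll = begin
      Σ₁ l l                                 ≡⟨ sumOver-remove M l (X l l) l∈M ⟩
      X l l l +ℚ sumOver (M ∖ l) (X l l)     ≡⟨ cong₂ _+ℚ_ (diag l) (sumOver-vanishes (M ∖ l) (X l l)
                                                  (λ δ δ∈M∖l → offDiag l δ (∈∖⇒≢ M l δ δ∈M∖l))) ⟩
      ℕtoℚ (p l ℕ.* p l) +ℚ 0ℚ               ≡⟨ ℚP.+-identityʳ _ ⟩
      ℕtoℚ (p l ℕ.* p l)                     ≡⟨ cong (λ v → ℕtoℚ (v ℕ.* v)) (p≡h l l∈M) ⟩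
      h²                                     ∎
    Σ₁-lγ : ∀ γ → (M ∖ l) γ ≡ true → Σ₁ l γ ≡ sumOver (M ∖ l ∖ γ) (X l γ)
    Σ₁-lγ γ γ∈M∖l = begin
      Σ₁ l γ
        ≡⟨ sumOver-remove M l (X l γ) l∈M ⟩
      X l γ l +ℚ sumOver (M ∖ l) (X l γ)
        ≡⟨ cong (X l γ l +ℚ_) (sumOver-remove (M ∖ l) γ (X l γ) γ∈M∖l) ⟩
      X l γ l +ℚ (X l γ γ +ℚ rest)
        ≡⟨ cong₂ (λ u v → u +ℚ (v +ℚ rest)) (X-iji≡0 R l γ l≢γ) (X-ijj≡0 R l γ l≢γ) ⟩
      0ℚ +ℚ (0ℚ +ℚ rest)
        ≡⟨ trans (ℚP.+-identityˡ _) (ℚP.+-identityˡ rest) ⟩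
      rest ∎
      where
      l≢γ = ∈∖⇒≢ M l γ γ∈M∖l
      rest = sumOver (M ∖ l ∖ γ) (X l γ)

  Σ₃-vanishes : c - 1ℚ - 1ℚ ≤ℚ 0ℚ → Σ₃ ≡ 0ℚ
  Σ₃-vanishes c-2≤0 = sumOver-vanishes M Σ₂≢ λ l l∈M → sumOver-vanishes (M ∖ l) _ λ γ γ∈M∖l →
    sumOver-size≤0 (M ∖ l ∖ γ) (X l γ)
      (ℚP.≤-trans (ℚP.≤-reflexive (size-remove₂ M l γ l∈M γ∈M∖l)) c-2≤0)

  Σ₃+Σ₂-outside : Σ₃ +ℚ sumOver (not ∘ M) Σ₂ ≡ (c - 1ℚ) * (c * h²)
  Σ₃+Σ₂-outside = begin
    Σ₃ +ℚ outside                          ≡⟨ rearrange total ⟩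
    c * (c * h²) - c * h²                  ≡⟨ solve 2 (λ c H → c :* (c :* H) :- c :* H
                                                           := (c :- con 1ℚ) :* (c :* H)) refl c h² ⟩
    (c - 1ℚ) * (c * h²)                    ∎
    where
    outside = sumOver (not ∘ M) Σ₂
    total : c * (c * h²) ≡ (c * h² +ℚ Σ₃) +ℚ outside
    total = begin
      c * (c * h²)                                  ≡⟨ sym sum-Σ₂ ⟩
      sum Σ₂                                        ≡⟨ sum-partition M Σ₂ ⟩
      sumOver M Σ₂ +ℚ outside                       ≡⟨ cong (_+ℚ outside) (sumOver-cong M Σ₂-inside) ⟩
      sumOver M (λ l → h² +ℚ Σ₂≢ l) +ℚ outside      ≡⟨ cong (_+ℚ outside) (sumOver-+ M (λ _ → h²) Σ₂≢) ⟩
      (sumOver M (λ _ → h²) +ℚ Σ₃) +ℚ outside       ≡⟨ cong (λ v → v +ℚ Σ₃ +ℚ outside) (sumOver-const M h²) ⟩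
      (c * h² +ℚ Σ₃) +ℚ outside                     ∎
    rearrange : ∀ {x y d t} → x ≡ (y +ℚ d) +ℚ t → d +ℚ t ≡ x - y
    rearrange {x} {y} {d} {t} refl = solve 3 (λ y d t → d :+ t := (y :+ d) :+ t :- y) refl y d t

  Y-row-diag : ∀ i → sum (Y i i) ≡ ℕtoℚ (p i ℕ.* p i)
  Y-row-diag i = trans (sum-supportedAt (Y i i) i (Y-offDiag i)) (Y-diag i)

  Y-row-outside : ∀ i j → M i ≡ false → M j ≡ false → sum (Y i j) ≡ ℕtoℚ (p i ℕ.* p j)
  Y-row-outside i j i∉M j∉M = begin
    sum (Y i j)                                   ≡⟨ Y-row-split i∉M j∉M ⟩
    sumOver M (λ _ → avg₁ i j) +ℚ Xᶜ              ≡⟨ cong (_+ℚ Xᶜ) (sumOver-const M (avg₁ i j)) ⟩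
    c * (Σ₁ i j * w₁) +ℚ Xᶜ                       ≡⟨ cong (_+ℚ Xᶜ) (*-inv⁺-cancel c (Σ₁ i j)
                                                                          (sumOver-size≤0 M (X i j))) ⟩
    Σ₁ i j +ℚ Xᶜ                                  ≡⟨ sym (sum-partition M (X i j)) ⟩
    sum (X i j)                                   ≡⟨ X-sum₃ R i j ⟩
    ℕtoℚ (p i ℕ.* p j)                            ∎
    where
    Xᶜ = sumOver (not ∘ M) (X i j)

  Y-row-mixed : ∀ i j → M i ≡ false → M j ≡ true → sum (Y i j) ≡ ℕtoℚ (p i ℕ.* p j)
  Y-row-mixed i j i∉M j∈M = begin
    sum (Y i j)
      ≡⟨ Y-row-split i∉M j∈M ⟩
    sumOver M (λ l → whenDistinct j l (avg₂ i)) +ℚ sumOver (not ∘ M) (λ l → avg₁ i l)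
      ≡⟨ cong₂ _+ℚ_ (trans (sumOver-whenDistinct M j (λ _ → avg₂ i)) (sumOver-const (M ∖ j) (avg₂ i)))
                    (sumOver-*ʳ (not ∘ M) (Σ₁ i) w₁) ⟩
    size (M ∖ j) * avg₂ i +ℚ Σ₁ᶜ * w₁
      ≡⟨ cong (λ s → s * avg₂ i +ℚ Σ₁ᶜ * w₁) (size-remove M j j∈M) ⟩
    (c - 1ℚ) * (Σ₂ i * (w₁ * inv⁺ (c - 1ℚ))) +ℚ Σ₁ᶜ * w₁
      ≡⟨ cong (_+ℚ Σ₁ᶜ * w₁) (*-inv⁺-cancel-weighted (c - 1ℚ) (Σ₂ i) w₁ (Σ₂-vanishes i i∉M)) ⟩
    Σ₂ i * w₁ +ℚ Σ₁ᶜ * w₁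
      ≡⟨ sym (ℚP.*-distribʳ-+ w₁ (Σ₂ i) Σ₁ᶜ) ⟩
    (Σ₂ i +ℚ Σ₁ᶜ) * w₁
      ≡⟨ cong (_* w₁) (trans (sym (sum-partition M (Σ₁ i))) (sum-Σ₁ i)) ⟩
    c * ℕtoℚ (p i ℕ.* h) * w₁
      ≡⟨ ℚP.*-assoc c _ w₁ ⟩
    c * (ℕtoℚ (p i ℕ.* h) * w₁)
      ≡⟨ *-inv⁺-cancel c _ (λ c≤0 → ⊥-elim (size≰0 M j j∈M c≤0)) ⟩
    ℕtoℚ (p i ℕ.* h)
      ≡⟨ cong (λ v → ℕtoℚ (p i ℕ.* v)) (sym (p≡h j j∈M)) ⟩
    ℕtoℚ (p i ℕ.* p j) ∎
    where
    Σ₁ᶜ = sumOver (not ∘ M) (Σ₁ i)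

  G-false : ∀ y z → G false y z ≡ (if z then 0ℚ else if y then 0ℚ else avg₃)
  G-false true  true  = refl
  G-false true  false = refl
  G-false false true  = refl
  G-false false false = refl

  Y-row-inside : ∀ i j → i ≢ j → M i ≡ true → M j ≡ true → sum (Y i j) ≡ ℕtoℚ (p i ℕ.* p j)
  Y-row-inside i j i≢j i∈M j∈M = begin
    sum (Y i j)
      ≡⟨ Y-row-split i∈M j∈M ⟩
    sumOver M (λ l → G (does (i ≟ j)) (does (j ≟ l)) (does (i ≟ l)))
      +ℚ sumOver (not ∘ M) (λ l → whenDistinct i j (avg₂ l))
      ≡⟨ cong₂ _+ℚ_ inside (sumOver-cong (not ∘ M) (λ l _ → whenDistinct-≢ (avg₂ l) i≢j)) ⟩
    (c - 1ℚ - 1ℚ) * (Σ₃ * (w₂ * inv⁺ (c - 1ℚ - 1ℚ))) +ℚ sumOver (not ∘ M) (λ l → Σ₂ l * w₂)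
      ≡⟨ cong₂ _+ℚ_ (*-inv⁺-cancel-weighted (c - 1ℚ - 1ℚ) Σ₃ w₂ Σ₃-vanishes)
                    (sumOver-*ʳ (not ∘ M) Σ₂ w₂) ⟩
    Σ₃ * w₂ +ℚ Σ₂ᶜ * w₂
      ≡⟨ sym (ℚP.*-distribʳ-+ w₂ Σ₃ Σ₂ᶜ) ⟩
    (Σ₃ +ℚ Σ₂ᶜ) * w₂
      ≡⟨ cong (_* w₂) Σ₃+Σ₂-outside ⟩
    (c - 1ℚ) * (c * h²) * w₂
      ≡⟨ ℚP.*-assoc (c - 1ℚ) (c * h²) w₂ ⟩
    (c - 1ℚ) * (c * h² * (w₁ * inv⁺ (c - 1ℚ)))
      ≡⟨ *-inv⁺-cancel-weighted (c - 1ℚ) (c * h²) w₁ (λ c-1≤0 → ⊥-elim (size≰0 (M ∖ i) j j∈M∖i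
           (ℚP.≤-trans (ℚP.≤-reflexive (size-remove M i i∈M)) c-1≤0))) ⟩
    c * h² * w₁
      ≡⟨ ℚP.*-assoc c h² w₁ ⟩
    c * (h² * w₁)
      ≡⟨ *-inv⁺-cancel c h² (λ c≤0 → ⊥-elim (size≰0 M i i∈M c≤0)) ⟩
    h²
      ≡⟨ sym (cong₂ (λ u v → ℕtoℚ (u ℕ.* v)) (p≡h i i∈M) (p≡h j j∈M)) ⟩
    ℕtoℚ (p i ℕ.* p j) ∎
    where
    j∈M∖i = ∈⇒∈∖ M i j j∈M i≢j
    Σ₂ᶜ = sumOver (not ∘ M) Σ₂
    inside : sumOver M (λ l → G (does (i ≟ j)) (does (j ≟ l)) (does (i ≟ l))) ≡ (c - 1ℚ - 1ℚ) * avg₃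
    inside = begin
      sumOver M (λ l → G (does (i ≟ j)) (does (j ≟ l)) (does (i ≟ l)))
        ≡⟨ sumOver-cong M (λ l _ →
             trans (cong (λ b → G b (does (j ≟ l)) (does (i ≟ l))) (dec-false (i ≟ j) i≢j))
                   (G-false (does (j ≟ l)) (does (i ≟ l)))) ⟩
      sumOver M (λ l → whenDistinct i l (whenDistinct j l avg₃))
        ≡⟨ sumOver-whenDistinct M i (λ l → whenDistinct j l avg₃) ⟩
      sumOver (M ∖ i) (λ l → whenDistinct j l avg₃)
        ≡⟨ sumOver-whenDistinct (M ∖ i) j (λ _ → avg₃) ⟩
      sumOver (M ∖ i ∖ j) (λ _ → avg₃)
        ≡⟨ sumOver-const (M ∖ i ∖ j) avg₃ ⟩
      size (M ∖ i ∖ j) * avg₃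
        ≡⟨ cong (_* avg₃) (size-remove₂ M i j i∈M j∈M∖i) ⟩
      (c - 1ℚ - 1ℚ) * avg₃ ∎

  Y-rowSum : ∀ i j → sum (Y i j) ≡ ℕtoℚ (p i ℕ.* p j)
  Y-rowSum i j with i ≟ j
  ... | yes refl = Y-row-diag i
  ... | no i≢j   = by-membership (M i) (M j) refl refl
    where
    by-membership : ∀ bi bj → M i ≡ bi → M j ≡ bj → sum (Y i j) ≡ ℕtoℚ (p i ℕ.* p j)
    by-membership false false i∉M j∉M = Y-row-outside i j i∉M j∉M
    by-membership false true  i∉M j∈M = Y-row-mixed i j i∉M j∈M
    by-membership true  false i∈M j∉M = begin
      sum (Y i j)          ≡⟨ sum-cong-≗ (λ l → Y-sym₁₂ i j l) ⟩
      sum (Y j i)          ≡⟨ Y-row-mixed j i j∉M i∈M ⟩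
      ℕtoℚ (p j ℕ.* p i)   ≡⟨ cong ℕtoℚ (ℕP.*-comm (p j) (p i)) ⟩
      ℕtoℚ (p i ℕ.* p j)   ∎
    by-membership true  true  i∈M j∈M = Y-row-inside i j i≢j i∈M j∈M

  Y-isROS : IsROS p Y
  Y-isROS = record
    { nonneg  = Y-nonneg
    ; sym₁₂   = Y-sym₁₂
    ; sym₂₃   = Y-sym₂₃
    ; rowSum  = λ i j → trans (sumFin≡sum (Y i j)) (Y-rowSum i j)
    ; diag    = Y-diag
    ; offDiag = Y-offDiag
    }

  Y-two-inside : ∀ {i α β} → M i ≡ false → M α ≡ true → M β ≡ true → α ≢ β → Y i α β ≡ avg₂ i
  Y-two-inside {i} i∉M α∈M β∈M α≢β = trans (Y-at i∉M α∈M β∈M) (whenDistinct-≢ (avg₂ i) α≢β)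

  Y-three-inside : ∀ {α β γ} → M α ≡ true → M β ≡ true → M γ ≡ true →
                   α ≢ β → α ≢ γ → β ≢ γ → Y α β γ ≡ avg₃
  Y-three-inside {α} {β} {γ} α∈M β∈M γ∈M α≢β α≢γ β≢γ
    rewrite Y-at α∈M β∈M γ∈M
          | dec-false (α ≟ β) α≢β | dec-false (β ≟ γ) β≢γ | dec-false (α ≟ γ) α≢γ = refl

does≡true⇒ : ∀ {A : Set} (a? : Dec A) → does a? ≡ true → A
does≡true⇒ (yes a) _  = a
does≡true⇒ (no _)  ()

module _ {k} (p : Fin k → ℕ) (a m h : ℕ) (p≡h : ∀ α → InBlock a m α → p α ≡ h) where

  inBlock? : (α : Fin k) → Dec (InBlock a m α)
  inBlock? α = (a ≤? toℕ α) ×-dec (toℕ α <? a + m)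

  ROS⇒SROS : ROS p → SROS p a m
  ROS⇒SROS (X , R) = Y , Y-isROS , record
    { Xija        = avg₁
    ; Xiaa        = avg₂
    ; Xaaa        = avg₃
    ; Xija-nonneg = avg₁-nonneg
    ; Xiaa-nonneg = avg₂-nonneg
    ; Xaaa-nonneg = avg₃-nonneg
    ; eq-ija      = λ i j α i∉M j∉M α∈M → Y-at (∉block i∉M) (∉block j∉M) (∈block α∈M)
    ; eq-iaa      = λ i α β i∉M α∈M β∈M → Y-two-inside (∉block i∉M) (∈block α∈M) (∈block β∈M)
    ; eq-aaa      = λ α β γ α∈M β∈M γ∈M → Y-three-inside (∈block α∈M) (∈block β∈M) (∈block γ∈M)
    }
    where
    open Symmetrisation R (does ∘ inBlock?) h (λ α α∈M → p≡h α (does≡true⇒ (inBlock? α) α∈M))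
    ∈block : ∀ {α} → InBlock a m α → does (inBlock? α) ≡ true
    ∈block {α} = dec-true (inBlock? α)
    ∉block : ∀ {α} → NotInBlock a m α → does (inBlock? α) ≡ false
    ∉block {α} = dec-false (inBlock? α)

mainTheorem12 : (k : ℕ) (p : Fin k → ℕ) → (∀ i → 1 ≤ p i) →
                (a m h : ℕ) → 1 ≤ m → a + m ≤ k →
                (∀ α → InBlock a m α → p α ≡ h) →
                ROS p ⇔ SROS p a m
mainTheorem12 k p _ a m h _ _ p≡h = mk⇔ (ROS⇒SROS p a m h p≡h) (λ (X , R , _) → X , R)
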